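{- Let $p\ge5$ be prime, $n=\frac{p-1}{2}$, $\alpha$ an integer whose reduction mod $p$ generates $(\mathbb{Z}/p\mathbb{Z})^\times$, $\beta\in\{\pm1,\pm5\}$ with $p\equiv\beta\pmod{12}$, and let $f=\prod_{i=0}^{n-1}E_i^{e_i}\prod_{j=1}^{n-1}F_j^{f_j}$ with $e_i,f_j\in\mathbb{Z}$ satisfying $\sum_{i=0}^{n-1}e_i\alpha^{2i}\equiv0\pmod p$, $\sum_{j=1}^{n-1}f_j\alpha^{2j}\equiv0\pmod p$ and $\sum_{i=0}^{n-1}pe_i+\sum_{j=1}^{n-1}f_j\equiv0\pmod{12}$. Put \[C_1=\frac1p\Big(e_{n-1}+\sum_{i=0}^{n-2}\alpha^{2i+2}e_i\Big),\] \[C_2=\frac1{12p}\Big(f_{n-1}+C_1\beta p-\sum_{i=1}^{n-2}f_i\big(-\alpha^{2i+2}+p\beta(\alpha^{2i+2}-1)\big)-\sum_{i=0}^{n-2}pe_i(\alpha^{2i+2}-1)\Big).\] Then $C_1,C_2\in\mathbb{Z}$ and \[f=\Big(\prod_{i=0}^{n-2}G_i^{e_i}\Big)\Big(\prod_{j=1}^{n-2}H_j^{f_j}\Big)G_{n-1}^{C_1}H_{n-1}^{C_2}.\]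
   Context: $B_2(x)=x^2-x+\frac16$. For $\mathbf{a}=(a_1,a_2)\in\mathbb{Q}^2\setminus\mathbb{Z}^2$, the Siegel function on the upper half plane is $g_{\mathbf a}(\tau)=-e^{\pi i a_2(a_1-1)}q_\tau^{B_2(a_1)/2}(1-q_z)\prod_{m\ge1}(1-q_\tau^mq_z)(1-q_\tau^m/q_z)$, with $z=a_1\tau+a_2$, $q_\tau=e^{2\pi i\tau}$, $q_z=e^{2\pi iz}$, $q_\tau^r=e^{2\pi i r\tau}$. For $0\le i\le n-1$, $E_i=g_{(\alpha^i/p,0)}\prod_{j=0}^{p-2}g_{(\alpha^i/p,\alpha^j/p)}$ and $F_i=g_{(0,\alpha^i/p)}$. For $0\le i\le n-2$: $G_i=E_iE_{n-1}^{ -\alpha^{2i+2}}F_{n-1}^{p(\alpha^{2i+2}-1)}$, $H_i=F_iF_{n-1}^{ -\alpha^{2i+2}+p\beta(\alpha^{2i+2}-1)}$; and $G_{n-1}=E_{n-1}^pF_{n-1}^{ -\beta p}$, $H_{n-1}=F_{n-1}^{12p}$. -}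

module Defs where

open import Level using (Level)
open import Data.Nat as ℕ using (ℕ; zero; suc; _∸_)
open import Data.Integer as ℤ using (ℤ; +_; -[1+_]; _+_; _*_; _-_; -_)
open import Data.Integer.Divisibility using (_∣_)
open import Data.Product using (∃)
open import Relation.Nullary using (¬_)
open import Algebra.Bundles using (AbelianGroup)

infixr 8 _^ℤ_
_^ℤ_ : ℤ → ℕ → ℤ
x ^ℤ zero  = + 1
x ^ℤ suc k = x * (x ^ℤ k)

∑ : ℕ → (ℕ → ℤ) → ℤ
∑ zero    g = + 0
∑ (suc k) g = ∑ k g + g k

GeneratesUnitsMod : ℕ → ℤ → Set
GeneratesUnitsMod p α = ∀ (x : ℤ) → ¬ (+ p ∣ x) → ∃ λ (k : ℕ) → + p ∣ (x - α ^ℤ k)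

data IsPm1Pm5 : ℤ → Set where
  b+1 : IsPm1Pm5 (+ 1)
  b-1 : IsPm1Pm5 (- + 1)
  b+5 : IsPm1Pm5 (+ 5)
  b-5 : IsPm1Pm5 (- + 5)

module GroupOps {c ℓ : Level} (A : AbelianGroup c ℓ) where
  open AbelianGroup A using (Carrier; _∙_; ε; _⁻¹)

  powℕ : Carrier → ℕ → Carrier
  powℕ x zero    = ε
  powℕ x (suc k) = x ∙ powℕ x k

  pow : Carrier → ℤ → Carrier
  pow x (+ k)    = powℕ x k
  pow x -[1+ k ] = (powℕ x (suc k)) ⁻¹

  ∏ : ℕ → (ℕ → Carrier) → Carrier
  ∏ zero    h = ε
  ∏ (suc k) h = ∏ k h ∙ h k

  module Units (p n : ℕ) (α β : ℤ) (E F : ℕ → Carrier) where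
    a2 : ℕ → ℤ
    a2 i = α ^ℤ (2 ℕ.* i ℕ.+ 2)

    G : ℕ → Carrier       -- for 0 ≤ i ≤ n-2
    G i = E i ∙ pow (E (n ∸ 1)) (- a2 i) ∙ pow (F (n ∸ 1)) (+ p * (a2 i - + 1))

    H : ℕ → Carrier       -- for 0 ≤ i ≤ n-2
    H i = F i ∙ pow (F (n ∸ 1)) (- a2 i + + p * β * (a2 i - + 1))

    Glast : Carrier
    Glast = pow (E (n ∸ 1)) (+ p) ∙ pow (F (n ∸ 1)) (- (β * + p))

    Hlast : Carrier
    Hlast = pow (F (n ∸ 1)) (+ (12 ℕ.* p))

a2 : ℤ → ℕ → ℤ
a2 α i = α ^ℤ (2 ℕ.* i ℕ.+ 2)

module _ {c ℓ : Level} (A : AbelianGroup c ℓ) where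
  open AbelianGroup A using (Carrier; _≈_; _∙_)
  open GroupOps A

  ProductIdentity : (p n : ℕ) (α β : ℤ) (E F : ℕ → Carrier) (e f : ℕ → ℤ) (C₁ C₂ : ℤ) → Set ℓ
  ProductIdentity p n α β E F e f C₁ C₂ =
    (∏ n (λ i → pow (E i) (e i)) ∙ ∏ (n ∸ 1) (λ j → pow (F (suc j)) (f (suc j))))
    ≈ (∏ (n ∸ 1) (λ i → pow (G i) (e i)) ∙ ∏ (n ∸ 2) (λ j → pow (H (suc j)) (f (suc j)))
       ∙ pow Glast C₁ ∙ pow Hlast C₂)
    where open Units p n α β E F

-- Expanding G_i, H_i, G_{n-1} and H_{n-1} in terms of the E_i and F_i, the right-hand side differs
-- from f only in the exponents of E_{n-1} and F_{n-1}, which are affine in C₁ and C₂; they equal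
-- e_{n-1} and f_{n-1} exactly when C₁ and C₂ are the quotients in the statement. For integrality,
-- multiply the two congruences mod p by α²: as α is a unit mod p, Fermat gives α^{2n} = α^{p-1} ≡ 1,
-- so p divides the numerators of C₁ and of C₂. Since p ≡ β and β² ≡ 1 (mod 12), the numerator of C₂
-- is congruent mod 12 to Σ p e_i + Σ f_j, and as p² ≡ 1 (mod 12) the two divisibilities combine to
-- divisibility by 12p. Fermat's little theorem itself comes from the binomial theorem via
-- (1 + x)^p ≡ x^p + 1 (mod p).
module Submission where

open import Defs
open import Level using (Level)
open import Function using (_∘_)
open import Data.Nat as ℕ using (ℕ; zero; suc; _∸_; _≥_; _!)
import Data.Nat.Properties as ℕ
import Data.Nat.Divisibility as ℕ
open import Data.Nat.DivMod using (_/_; m/n*n≡m)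
open import Data.Nat.Combinatorics using (_C_; nCk≡n!/k![n-k]!; k![n∸k]!∣n!; nCn≡1)
open import Data.Nat.Primality using (Prime; euclidsLemma; prime⇒nonZero; prime⇒nonTrivial)
open import Data.Fin as Fin using (Fin; toℕ; fromℕ; inject₁)
import Data.Fin.Properties as Fin
open import Data.Integer as ℤ using (ℤ; +_; -[1+_]; _+_; _*_; _-_; -_; ∣_∣)
import Data.Integer.Properties as ℤ
open import Data.Integer.Divisibility using (_∣_)
open import Data.Integer.Divisibility.Signed renaming (_∣_ to _∣ₛ_)
open import Data.Integer.Tactic.RingSolver using (solve-∀)
open import Data.Product using (∃₂; _×_; _,_)
open import Data.Sum using (inj₁; inj₂)
open import Relation.Nullary using (¬_; contradiction)
open import Relation.Binary.PropositionalEquality using (_≡_; refl; sym; trans; cong; cong₂; subst; module ≡-Reasoning)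
open import Algebra.Bundles using (AbelianGroup)
open import Algebra.Properties.CommutativeSemiring.Binomial ℤ.+-*-commutativeSemiring
  using () renaming (theorem to binomial-theorem)
open import Algebra.Properties.Monoid.Sum ℤ.+-0-monoid using (sum; sum-init-last)
open import Algebra.Definitions.RawSemiring ℤ.+-*-rawSemiring using () renaming (_^_ to _^ˢ_; _×_ to _×ˢ_)

∑-cong : ∀ k {g h : ℕ → ℤ} → (∀ i → g i ≡ h i) → ∑ k g ≡ ∑ k h
∑-cong zero    g≗h = refl
∑-cong (suc k) g≗h = cong₂ _+_ (∑-cong k g≗h) (g≗h k)

∑-*ˡ : ∀ k c (g : ℕ → ℤ) → ∑ k (λ i → c * g i) ≡ c * ∑ k g
∑-*ˡ zero    c g = sym (ℤ.*-zeroʳ c)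
∑-*ˡ (suc k) c g = trans (cong (_+ c * g k) (∑-*ˡ k c g)) (sym (ℤ.*-distribˡ-+ c (∑ k g) (g k)))

∑-+ : ∀ k (g h : ℕ → ℤ) → ∑ k (λ i → g i + h i) ≡ ∑ k g + ∑ k h
∑-+ zero    g h = refl
∑-+ (suc k) g h = trans (cong (_+ (g k + h k)) (∑-+ k g h)) (interchange (∑ k g) (∑ k h) (g k) (h k))
  where
  interchange : ∀ a b c d → a + b + (c + d) ≡ a + c + (b + d)
  interchange = solve-∀

∑-linear : ∀ k x y (g h : ℕ → ℤ) → ∑ k (λ i → x * g i + y * h i) ≡ x * ∑ k g + y * ∑ k h
∑-linear k x y g h = trans (∑-+ k _ _) (cong₂ _+_ (∑-*ˡ k x g) (∑-*ˡ k y h))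

^ℤ-+ : ∀ x m k → x ^ℤ (m ℕ.+ k) ≡ x ^ℤ m * x ^ℤ k
^ℤ-+ x zero    k = sym (ℤ.*-identityˡ _)
^ℤ-+ x (suc m) k = trans (cong (x *_) (^ℤ-+ x m k)) (sym (ℤ.*-assoc x _ _))

1^ℤ : ∀ k → (+ 1) ^ℤ k ≡ + 1
1^ℤ zero    = refl
1^ℤ (suc k) = trans (ℤ.*-identityˡ _) (1^ℤ k)

^ℤ≗^ˢ : ∀ x k → x ^ℤ k ≡ x ^ˢ k
^ℤ≗^ˢ x zero    = refl
^ℤ≗^ˢ x (suc k) = cong (x *_) (^ℤ≗^ˢ x k)

×ˢ≗* : ∀ c x → c ×ˢ x ≡ + c * x
×ˢ≗* zero    x = sym (ℤ.*-zeroˡ x)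
×ˢ≗* (suc c) x = trans (cong (λ y → x + y) (×ˢ≗* c x)) (sym (ℤ.suc-* (+ c) x))

∣-sum : ∀ {d n} (t : Fin n → ℤ) → (∀ i → d ∣ₛ t i) → d ∣ₛ sum t
∣-sum {d} {zero}  t d∣t = divides (+ 0) (sym (ℤ.*-zeroˡ d))
∣-sum {n = suc n} t d∣t = ∣m∣n⇒∣m+n (d∣t Fin.zero) (∣-sum (t ∘ Fin.suc) (d∣t ∘ Fin.suc))

∣x+uy∧∣u-1⇒∣x+y : ∀ {d x y u} → d ∣ₛ x + u * y → d ∣ₛ u - + 1 → d ∣ₛ x + y
∣x+uy∧∣u-1⇒∣x+y {d} {x} {y} {u} d∣x+uy d∣u-1 =
  subst (d ∣ₛ_) (reduce x y u) (∣m∣n⇒∣m-n d∣x+uy (∣m⇒∣m*n y d∣u-1))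
  where
  reduce : ∀ x y u → x + u * y - (u - + 1) * y ≡ x + y
  reduce = solve-∀

∣∧∣⇒*∣ : ∀ {m n k x} → m ∣ₛ x → n ∣ₛ x → m ∣ₛ n * k - + 1 → m * n ∣ₛ x
∣∧∣⇒*∣ {m} {n} {k} {x} m∣x n∣x m∣nk-1 =
  subst (m * n ∣ₛ_) (cancel x n k) (∣m∣n⇒∣m-n mn∣xnk mn∣[nk-1]x)
  where
  cancel : ∀ x n k → x * n * k - (n * k - + 1) * x ≡ x
  cancel = solve-∀
  mn∣xnk : m * n ∣ₛ x * n * k
  mn∣xnk = ∣m⇒∣m*n k (*-monoˡ-∣ n m∣x)
  mn∣[nk-1]x : m * n ∣ₛ (n * k - + 1) * x
  mn∣[nk-1]x = ∣-trans (*-monoˡ-∣ n m∣nk-1) (*-monoʳ-∣ (n * k - + 1) n∣x)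

quotient-spec : ∀ {d x} (d∣x : d ∣ₛ x) → d * _∣ₛ_.quotient d∣x ≡ x
quotient-spec {d} d∣x = trans (ℤ.*-comm d _) (sym (_∣ₛ_.equality d∣x))

module _ {d a b : ℤ} (d∣a-b : d ∣ₛ a - b) (d∣b²-1 : d ∣ₛ b * b - + 1) where

  ∣a²-1 : d ∣ₛ a * a - + 1
  ∣a²-1 = subst (d ∣ₛ_) (expand a b) (∣m∣n⇒∣m+n (∣m⇒∣m*n (a + b) d∣a-b) d∣b²-1)
    where
    expand : ∀ a b → (a - b) * (a + b) + (b * b - + 1) ≡ a * a - + 1
    expand = solve-∀

  ∣1-ab : d ∣ₛ + 1 - a * b
  ∣1-ab = subst (d ∣ₛ_) (expand a b) (∣m⇒∣-m (∣m∣n⇒∣m+n (∣n⇒∣m*n b d∣a-b) d∣b²-1))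
    where
    expand : ∀ a b → - (b * (a - b) + (b * b - + 1)) ≡ + 1 - a * b
    expand = solve-∀

12∣β²-1 : ∀ {β} → IsPm1Pm5 β → + 12 ∣ₛ β * β - + 1
12∣β²-1 b+1 = divides (+ 0) refl
12∣β²-1 b-1 = divides (+ 0) refl
12∣β²-1 b+5 = divides (+ 2) refl
12∣β²-1 b-5 = divides (+ 2) refl

n∣n! : ∀ n .{{_ : ℕ.NonZero n}} → n ℕ.∣ n !
n∣n! (suc n) = ℕ.m∣m*n (n !)

module _ {p : ℕ} (prime-p : Prime p) where

  prime∤! : ∀ {m} → m ℕ.< p → ¬ p ℕ.∣ m !
  prime∤! {zero}  m<p p∣1 =
    contradiction (ℕ.∣1⇒≡1 p∣1) (ℕ.>⇒≢ (ℕ.nonTrivial⇒n>1 p {{prime⇒nonTrivial prime-p}}))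
  prime∤! {suc m} m<p p∣m! with euclidsLemma (suc m) (m !) prime-p p∣m!
  ... | inj₁ p∣1+m = ℕ.<⇒≱ m<p (ℕ.∣⇒≤ p∣1+m)
  ... | inj₂ p∣m!  = prime∤! (ℕ.<-trans (ℕ.n<1+n m) m<p) p∣m!

  prime∣C : ∀ {k} → 0 ℕ.< k → k ℕ.< p → p ℕ.∣ p C k
  prime∣C {k} 0<k k<p with euclidsLemma (p C k) (k ! ℕ.* (p ∸ k) !) prime-p p∣C*k!*[p-k]!
    where
    C*k!*[p-k]!≡p! : (p C k) ℕ.* (k ! ℕ.* (p ∸ k) !) ≡ p !
    C*k!*[p-k]!≡p! = begin
      (p C k) ℕ.* (k ! ℕ.* (p ∸ k) !)
        ≡⟨ cong (ℕ._* (k ! ℕ.* (p ∸ k) !)) (nCk≡n!/k![n-k]! k≤p) ⟩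
      p ! / (k ! ℕ.* (p ∸ k) !) ℕ.* (k ! ℕ.* (p ∸ k) !)
        ≡⟨ m/n*n≡m (k![n∸k]!∣n! k≤p) ⟩
      p ! ∎
      where
      open ≡-Reasoning
      instance
        k!*[p-k]!≢0 : ℕ.NonZero (k ! ℕ.* (p ∸ k) !)
        k!*[p-k]!≢0 = k ℕ.!* (p ∸ k) !≢0
      k≤p : k ℕ.≤ p
      k≤p = ℕ.<⇒≤ k<p
    p∣C*k!*[p-k]! : p ℕ.∣ (p C k) ℕ.* (k ! ℕ.* (p ∸ k) !)
    p∣C*k!*[p-k]! = subst (p ℕ.∣_) (sym C*k!*[p-k]!≡p!) (n∣n! p {{prime⇒nonZero prime-p}})
  ... | inj₁ p∣C = p∣C
  ... | inj₂ p∣k!*[p-k]! with euclidsLemma (k !) ((p ∸ k) !) prime-p p∣k!*[p-k]!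
  ...   | inj₁ p∣k!     = contradiction p∣k! (prime∤! k<p)
  ...   | inj₂ p∣[p-k]! = contradiction p∣[p-k]! (prime∤! (ℕ.∸-monoʳ-< 0<k (ℕ.<⇒≤ k<p)))

  p∣ab∧p∤a⇒p∣b : ∀ {a b} → + p ∣ₛ a * b → ¬ + p ∣ₛ a → + p ∣ₛ b
  p∣ab∧p∤a⇒p∣b {a} {b} p∣ab p∤a
    with euclidsLemma ∣ a ∣ ∣ b ∣ prime-p (subst (p ℕ.∣_) (ℤ.abs-* a b) (∣⇒∣ᵤ p∣ab))
  ... | inj₁ p∣a = contradiction (∣ᵤ⇒∣ p∣a) p∤a
  ... | inj₂ p∣b = ∣ᵤ⇒∣ p∣b

module _ {q : ℕ} (prime-p : Prime (suc q)) where

  private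
    p : ℕ
    p = suc q

  freshmans-dream : ∀ x → + p ∣ₛ (+ 1 + x) ^ℤ p - (x ^ℤ p + + 1)
  freshmans-dream x = subst (+ p ∣ₛ_) (sym expansion) (∣-sum inner p∣inner)
    where
    open ≡-Reasoning
    term : ℕ → ℤ
    term j = (p C j) ×ˢ ((+ 1) ^ˢ j * x ^ˢ (p ∸ j))
    inner : Fin q → ℤ
    inner j = term (suc (toℕ (inject₁ j)))
    term₀≡xᵖ : term 0 ≡ x ^ℤ p
    term₀≡xᵖ = trans (ℤ.+-identityʳ _) (trans (ℤ.*-identityˡ _) (sym (^ℤ≗^ˢ x p)))
    termₚ≡1 : term (suc (toℕ (fromℕ q))) ≡ + 1
    termₚ≡1 = begin
      term (suc (toℕ (fromℕ q)))   ≡⟨ cong (term ∘ suc) (Fin.toℕ-fromℕ q) ⟩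
      term p                       ≡⟨ cong₂ (λ c k → c ×ˢ ((+ 1) ^ˢ p * x ^ˢ k)) (nCn≡1 p) (ℕ.n∸n≡0 p) ⟩
      (+ 1) ^ˢ p * + 1 + + 0       ≡⟨ trans (ℤ.+-identityʳ _) (ℤ.*-identityʳ _) ⟩
      (+ 1) ^ˢ p                   ≡⟨ ^ℤ≗^ˢ (+ 1) p ⟨
      (+ 1) ^ℤ p                   ≡⟨ 1^ℤ p ⟩
      + 1                          ∎
    cancel : ∀ a b → b + (a + + 1) - (b + + 1) ≡ a
    cancel = solve-∀
    expansion : (+ 1 + x) ^ℤ p - (x ^ℤ p + + 1) ≡ sum inner
    expansion = begin
      (+ 1 + x) ^ℤ p - (x ^ℤ p + + 1)
        ≡⟨ cong (_- (x ^ℤ p + + 1)) (trans (^ℤ≗^ˢ (+ 1 + x) p) (binomial-theorem p (+ 1) x)) ⟩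
      term 0 + sum (term ∘ toℕ ∘ Fin.suc {p}) - (x ^ℤ p + + 1)
        ≡⟨ cong (λ s → term 0 + s - (x ^ℤ p + + 1)) (sum-init-last (term ∘ toℕ ∘ Fin.suc {p})) ⟩
      term 0 + (sum inner + term (suc (toℕ (fromℕ q)))) - (x ^ℤ p + + 1)
        ≡⟨ cong₂ (λ a b → a + (sum inner + b) - (x ^ℤ p + + 1)) term₀≡xᵖ termₚ≡1 ⟩
      x ^ℤ p + (sum inner + + 1) - (x ^ℤ p + + 1)
        ≡⟨ cancel (sum inner) (x ^ℤ p) ⟩
      sum inner ∎
    p∣inner : ∀ j → + p ∣ₛ inner j
    p∣inner j = subst (+ p ∣ₛ_) (sym (×ˢ≗* (p C suc i) _)) (∣m⇒∣m*n _ p∣C)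
      where
      i : ℕ
      i = toℕ (inject₁ j)
      i<q : i ℕ.< q
      i<q = subst (ℕ._< q) (sym (Fin.toℕ-inject₁ j)) (Fin.toℕ<n j)
      p∣C : + p ∣ₛ + (p C suc i)
      p∣C = ∣ᵤ⇒∣ (prime∣C prime-p (ℕ.s≤s ℕ.z≤n) (ℕ.s<s i<q))

  fermat-step : ∀ x → (+ 1 + x) ^ℤ p - (+ 1 + x) ≡ ((+ 1 + x) ^ℤ p - (x ^ℤ p + + 1)) + (x ^ℤ p - x)
  fermat-step x = regroup ((+ 1 + x) ^ℤ p) (x ^ℤ p) x
    where
    regroup : ∀ a b x → a - (+ 1 + x) ≡ (a - (b + + 1)) + (b - x)
    regroup = solve-∀

  fermat-up : ∀ x → + p ∣ₛ x ^ℤ p - x → + p ∣ₛ (+ 1 + x) ^ℤ p - (+ 1 + x)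
  fermat-up x p∣xᵖ-x = subst (+ p ∣ₛ_) (sym (fermat-step x)) (∣m∣n⇒∣m+n (freshmans-dream x) p∣xᵖ-x)

  fermat-down : ∀ x → + p ∣ₛ (+ 1 + x) ^ℤ p - (+ 1 + x) → + p ∣ₛ x ^ℤ p - x
  fermat-down x p∣[1+x]ᵖ-[1+x] = ∣m+n∣m⇒∣n (subst (+ p ∣ₛ_) (fermat-step x) p∣[1+x]ᵖ-[1+x]) (freshmans-dream x)

  -- Since the step x ↦ 1 + x can also be taken backwards, the induction covers the negative integers.
  fermat : ∀ x → + p ∣ₛ x ^ℤ p - x
  fermat (+ zero)     = divides (+ 0) refl
  fermat (+ suc k)    = fermat-up (+ k) (fermat (+ k))
  fermat -[1+ zero ]  = fermat-down -[1+ 0 ] (fermat (+ 0))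
  fermat -[1+ suc k ] = fermat-down -[1+ suc k ] (fermat -[1+ k ])

fermat-unit : ∀ {p} → Prime p → ∀ x → ¬ + p ∣ₛ x → + p ∣ₛ x ^ℤ (p ∸ 1) - + 1
fermat-unit {zero}  prime-p x = contradiction refl (ℕ.≢-nonZero⁻¹ 0 {{prime⇒nonZero prime-p}})
fermat-unit {suc q} prime-p x =
  p∣ab∧p∤a⇒p∣b prime-p (subst (+ suc q ∣ₛ_) (factor x (x ^ℤ q)) (fermat prime-p x))
  where
  factor : ∀ x y → x * y - x ≡ x * (y - + 1)
  factor = solve-∀

-- 2 is a power of α modulo p; if p ∣ α, then p would divide 2 - 1 or 2.
generator⇒p∤ : ∀ {p α} → 2 ℕ.< p → GeneratesUnitsMod p α → ¬ + p ∣ₛ α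
generator⇒p∤ {p} {α} 2<p generates p∣α with generates (+ 2) (ℕ.>⇒∤ 2<p)
... | zero  , p∣2-1    = ℕ.>⇒∤ (ℕ.<-trans (ℕ.s≤s (ℕ.s≤s ℕ.z≤n)) 2<p) p∣2-1
... | suc k , p∣2-αᵏ⁺¹ = ℕ.>⇒∤ 2<p (∣⇒∣ᵤ (subst (+ p ∣ₛ_) (cancel (+ 2) (α ^ℤ suc k)) p∣2))
  where
  cancel : ∀ a b → a - b + b ≡ a
  cancel = solve-∀
  p∣2 : + p ∣ₛ + 2 - α ^ℤ suc k + α ^ℤ suc k
  p∣2 = ∣m∣n⇒∣m+n (∣ᵤ⇒∣ {+ p} {+ 2 - α ^ℤ suc k} p∣2-αᵏ⁺¹) (∣m⇒∣m*n (α ^ℤ k) p∣α)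

∣-shift-weights : ∀ {d} α k (g : ℕ → ℤ) (h : ℕ → ℕ) → d ∣ₛ α ^ℤ (2 ℕ.* h k ℕ.+ 2) - + 1 →
  d ∣ₛ ∑ (suc k) (λ i → g i * α ^ℤ (2 ℕ.* h i)) → d ∣ₛ g k + ∑ k (λ i → a2 α (h i) * g i)
∣-shift-weights {d} α k g h d∣α²ʰ⁺²-1 d∣∑ =
  subst (d ∣ₛ_) (ℤ.+-comm _ (g k))
    (∣x+uy∧∣u-1⇒∣x+y {x = ∑ k (λ i → a2 α (h i) * g i)} {u = a2 α (h k)} d∣α²∑ d∣α²ʰ⁺²-1)
  where
  regroup : ∀ a b c → a * (b * c) ≡ c * a * b
  regroup = solve-∀
  shift : ∀ i → α ^ℤ 2 * (g i * α ^ℤ (2 ℕ.* h i)) ≡ a2 α (h i) * g i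
  shift i = trans (regroup (α ^ℤ 2) (g i) _) (cong (_* g i) (sym (^ℤ-+ α (2 ℕ.* h i) 2)))
  d∣α²∑ : d ∣ₛ ∑ (suc k) (λ i → a2 α (h i) * g i)
  d∣α²∑ = subst (d ∣ₛ_) (trans (sym (∑-*ˡ (suc k) (α ^ℤ 2) _)) (∑-cong (suc k) shift))
                        (∣n⇒∣m*n (α ^ℤ 2) d∣∑)

-- The paper's n is m + 2 here.
module Exponents (p m : ℕ) (α β : ℤ) (e f : ℕ → ℤ) where

  H-exponent : ℕ → ℤ
  H-exponent i = - a2 α i + + p * β * (a2 α i - + 1)

  C₁-numerator : ℤ
  C₁-numerator = e (suc m) + ∑ (suc m) (λ i → a2 α i * e i)

  C₂-numerator : ℤ → ℤ
  C₂-numerator C₁ = f (suc m) + C₁ * β * + p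
                  - ∑ m (λ i → f (suc i) * H-exponent (suc i))
                  - ∑ (suc m) (λ i → + p * e i * (a2 α i - + 1))

  -- The exponents of E_{n-1} and F_{n-1} on the right-hand side, once G_i, H_i are expanded.
  E-exponent : ℤ → ℤ
  E-exponent C₁ = ∑ (suc m) (λ i → - a2 α i * e i) + + p * C₁

  F-exponent : ℤ → ℤ → ℤ
  F-exponent C₁ C₂ = ∑ (suc m) (λ i → + p * (a2 α i - + 1) * e i) + ∑ m (λ i → H-exponent (suc i) * f (suc i))
                   + - (β * + p) * C₁ + + (12 ℕ.* p) * C₂

  private
    P A Σe Fa Σf : ℤ
    P = + p
    A = ∑ (suc m) (λ i → a2 α i * e i)
    Σe = ∑ (suc m) e
    Fa = ∑ m (λ i → a2 α (suc i) * f (suc i))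
    Σf = ∑ m (f ∘ suc)

  E-exponent≡ : ∀ {C₁} → P * C₁ ≡ C₁-numerator → E-exponent C₁ ≡ e (suc m)
  E-exponent≡ {C₁} pC₁≡num = begin
    ∑ (suc m) (λ i → - a2 α i * e i) + P * C₁  ≡⟨ cong₂ _+_ ∑-neg pC₁≡num ⟩
    - + 1 * A + (e (suc m) + A)                 ≡⟨ cancel (e (suc m)) A ⟩
    e (suc m)                                   ∎
    where
    open ≡-Reasoning
    pull-sign : ∀ a e → - a * e ≡ - + 1 * (a * e)
    pull-sign = solve-∀
    ∑-neg : ∑ (suc m) (λ i → - a2 α i * e i) ≡ - + 1 * A
    ∑-neg = trans (∑-cong (suc m) λ i → pull-sign (a2 α i) (e i)) (∑-*ˡ (suc m) (- + 1) _)
    cancel : ∀ e A → - + 1 * A + (e + A) ≡ e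
    cancel = solve-∀

  F-exponent≡ : ∀ {C₁ C₂} → + (12 ℕ.* p) * C₂ ≡ C₂-numerator C₁ → F-exponent C₁ C₂ ≡ f (suc m)
  F-exponent≡ {C₁} {C₂} 12pC₂≡num = begin
    F-exponent C₁ C₂
      ≡⟨ cong₂ (λ s t → s + t + - (β * P) * C₁ + + (12 ℕ.* p) * C₂) ∑e≡ ∑f≡ ⟩
    Se + Sf + - (β * P) * C₁ + + (12 ℕ.* p) * C₂
      ≡⟨ cong (λ x → Se + Sf + - (β * P) * C₁ + x) 12pC₂≡num ⟩
    Se + Sf + - (β * P) * C₁ + (f (suc m) + C₁ * β * P - Sf - Se)
      ≡⟨ cancel Se Sf (f (suc m)) C₁ β P ⟩
    f (suc m) ∎
    where
    open ≡-Reasoning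
    Se Sf : ℤ
    Se = ∑ (suc m) (λ i → P * e i * (a2 α i - + 1))
    Sf = ∑ m (λ i → f (suc i) * H-exponent (suc i))
    swap : ∀ p a e → p * (a - + 1) * e ≡ p * e * (a - + 1)
    swap = solve-∀
    ∑e≡ : ∑ (suc m) (λ i → P * (a2 α i - + 1) * e i) ≡ Se
    ∑e≡ = ∑-cong (suc m) λ i → swap P (a2 α i) (e i)
    ∑f≡ : ∑ m (λ i → H-exponent (suc i) * f (suc i)) ≡ Sf
    ∑f≡ = ∑-cong m λ i → ℤ.*-comm (H-exponent (suc i)) (f (suc i))
    cancel : ∀ Se Sf f C β P → Se + Sf + - (β * P) * C + (f + C * β * P - Sf - Se) ≡ f
    cancel = solve-∀

  C₂-numerator≡ : ∀ {C₁} → P * C₁ ≡ C₁-numerator →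
    C₂-numerator C₁ ≡ f (suc m) + Fa + β * C₁-numerator - P * β * (Fa - Σf) - P * A + P * Σe
  C₂-numerator≡ {C₁} pC₁≡num = begin
    C₂-numerator C₁
      ≡⟨ cong₂ (λ s t → f (suc m) + C₁ * β * P - s - t) ∑f≡ ∑e≡ ⟩
    f (suc m) + C₁ * β * P - ((- + 1 + P * β) * Fa + - (P * β) * Σf) - (P * A + - P * Σe)
      ≡⟨ cong (λ t → f (suc m) + t - ((- + 1 + P * β) * Fa + - (P * β) * Σf) - (P * A + - P * Σe)) C₁βp≡βpC₁ ⟩
    f (suc m) + β * C₁-numerator - ((- + 1 + P * β) * Fa + - (P * β) * Σf) - (P * A + - P * Σe)
      ≡⟨ regroup (f (suc m)) β C₁-numerator P Fa Σf A Σe ⟩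
    f (suc m) + Fa + β * C₁-numerator - P * β * (Fa - Σf) - P * A + P * Σe ∎
    where
    open ≡-Reasoning
    split-f : ∀ f a q → f * (- a + q * (a - + 1)) ≡ (- + 1 + q) * (a * f) + - q * f
    split-f = solve-∀
    split-e : ∀ p e a → p * e * (a - + 1) ≡ p * (a * e) + - p * e
    split-e = solve-∀
    ∑f≡ : ∑ m (λ i → f (suc i) * H-exponent (suc i)) ≡ (- + 1 + P * β) * Fa + - (P * β) * Σf
    ∑f≡ = trans (∑-cong m λ i → split-f (f (suc i)) (a2 α (suc i)) (P * β))
                (∑-linear m (- + 1 + P * β) (- (P * β)) (λ i → a2 α (suc i) * f (suc i)) (f ∘ suc))
    ∑e≡ : ∑ (suc m) (λ i → P * e i * (a2 α i - + 1)) ≡ P * A + - P * Σe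
    ∑e≡ = trans (∑-cong (suc m) λ i → split-e P (e i) (a2 α i)) (∑-linear (suc m) P (- P) (λ i → a2 α i * e i) e)
    rearrange : ∀ C β P → C * β * P ≡ β * (P * C)
    rearrange = solve-∀
    C₁βp≡βpC₁ : C₁ * β * P ≡ β * C₁-numerator
    C₁βp≡βpC₁ = trans (rearrange C₁ β P) (cong (β *_) pC₁≡num)
    regroup : ∀ f β T P Fa Σf A Σe →
      f + β * T - ((- + 1 + P * β) * Fa + - (P * β) * Σf) - (P * A + - P * Σe)
      ≡ f + Fa + β * T - P * β * (Fa - Σf) - P * A + P * Σe
    regroup = solve-∀

  p∣C₂-numerator : ∀ {C₁} → P * C₁ ≡ C₁-numerator → P ∣ₛ f (suc m) + Fa → P ∣ₛ C₂-numerator C₁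
  p∣C₂-numerator {C₁} pC₁≡num p∣f+Fa =
    subst (P ∣ₛ_) (sym (trans (C₂-numerator≡ pC₁≡num) (regroup (f (suc m) + Fa) β C₁-numerator P Fa Σf A Σe)))
      (∣m∣n⇒∣m+n (∣m∣n⇒∣m+n p∣f+Fa (∣n⇒∣m*n β p∣num)) (∣m⇒∣m*n (- β * (Fa - Σf) - A + Σe) ∣-refl))
    where
    p∣num : P ∣ₛ C₁-numerator
    p∣num = divides C₁ (trans (sym pC₁≡num) (ℤ.*-comm P C₁))
    regroup : ∀ g β T P Fa Σf A Σe →
      g + β * T - P * β * (Fa - Σf) - P * A + P * Σe ≡ g + β * T + P * (- β * (Fa - Σf) - A + Σe)
    regroup = solve-∀

  12∣C₂-numerator : ∀ {C₁} → P * C₁ ≡ C₁-numerator → + 12 ∣ₛ P - β → + 12 ∣ₛ β * β - + 1 →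
    + 12 ∣ₛ ∑ (suc (suc m)) (λ i → P * e i) + ∑ (suc m) (f ∘ suc) → + 12 ∣ₛ C₂-numerator C₁
  12∣C₂-numerator {C₁} pC₁≡num 12∣p-β 12∣β²-1 12∣Σ = subst (+ 12 ∣ₛ_) (sym num≡)
    (∣m∣n⇒∣m+n (∣m∣n⇒∣m+n 12∣Σ (∣m⇒∣m*n (Fa - Σf) (∣1-ab {a = P} {b = β} 12∣p-β 12∣β²-1)))
               (∣m⇒∣m*n C₁-numerator (∣m⇒∣-m {m = P - β} 12∣p-β)))
    where
    open ≡-Reasoning
    regroup : ∀ e′ f′ β P Fa Σf A Σe →
      f′ + Fa + β * (e′ + A) - P * β * (Fa - Σf) - P * A + P * Σe
      ≡ P * Σe + P * e′ + (Σf + f′) + (+ 1 - P * β) * (Fa - Σf) + - (P - β) * (e′ + A)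
    regroup = solve-∀
    num≡ : C₂-numerator C₁ ≡ ∑ (suc (suc m)) (λ i → P * e i) + ∑ (suc m) (f ∘ suc)
                             + (+ 1 - P * β) * (Fa - Σf) + - (P - β) * C₁-numerator
    num≡ = begin
      C₂-numerator C₁
        ≡⟨ C₂-numerator≡ pC₁≡num ⟩
      f (suc m) + Fa + β * C₁-numerator - P * β * (Fa - Σf) - P * A + P * Σe
        ≡⟨ regroup (e (suc m)) (f (suc m)) β P Fa Σf A Σe ⟩
      P * Σe + P * e (suc m) + (Σf + f (suc m)) + (+ 1 - P * β) * (Fa - Σf) + - (P - β) * C₁-numerator
        ≡⟨ cong (λ s → s + P * e (suc m) + (Σf + f (suc m)) + (+ 1 - P * β) * (Fa - Σf) + - (P - β) * C₁-numerator)
                (sym (∑-*ˡ (suc m) P e)) ⟩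
      ∑ (suc (suc m)) (λ i → P * e i) + ∑ (suc m) (f ∘ suc) + (+ 1 - P * β) * (Fa - Σf) + - (P - β) * C₁-numerator ∎

  12p∣C₂-numerator : ∀ {C₁} → P * C₁ ≡ C₁-numerator → P ∣ₛ f (suc m) + Fa →
    + 12 ∣ₛ P - β → IsPm1Pm5 β → + 12 ∣ₛ ∑ (suc (suc m)) (λ i → P * e i) + ∑ (suc m) (f ∘ suc) →
    + (12 ℕ.* p) ∣ₛ C₂-numerator C₁
  12p∣C₂-numerator {C₁} pC₁≡num p∣f+Fa 12∣p-β β∈ 12∣Σ =
    subst (_∣ₛ C₂-numerator C₁) (sym (ℤ.pos-* 12 p))
      (∣∧∣⇒*∣ (12∣C₂-numerator pC₁≡num 12∣p-β (12∣β²-1 β∈) 12∣Σ)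
              (p∣C₂-numerator pC₁≡num p∣f+Fa)
              (∣a²-1 {a = P} {b = β} 12∣p-β (12∣β²-1 β∈)))

module IntegerPowers {a ℓ : Level} (𝔾 : AbelianGroup a ℓ) where

  open AbelianGroup 𝔾 hiding (_-_) renaming (refl to ≈-refl; sym to ≈-sym; trans to ≈-trans)
  open GroupOps 𝔾
  open import Algebra.Properties.AbelianGroup 𝔾 using (ε⁻¹≈ε; ⁻¹-∙-comm; ⁻¹-involutive)
  open import Algebra.Properties.CommutativeSemigroup commutativeSemigroup using (interchange; x∙yz≈y∙xz)
  open import Relation.Binary.Reasoning.Setoid setoid

  powℕ-+ : ∀ x m k → powℕ x (m ℕ.+ k) ≈ powℕ x m ∙ powℕ x k
  powℕ-+ x zero    k = ≈-sym (identityˡ _)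
  powℕ-+ x (suc m) k = ≈-trans (∙-congˡ (powℕ-+ x m k)) (≈-sym (assoc _ _ _))

  powℕ-∙ : ∀ x y m → powℕ (x ∙ y) m ≈ powℕ x m ∙ powℕ y m
  powℕ-∙ x y zero    = ≈-sym (identityˡ ε)
  powℕ-∙ x y (suc m) = ≈-trans (∙-congˡ (powℕ-∙ x y m)) (interchange _ _ _ _)

  pow-⊖ : ∀ x m k → pow x (m ℤ.⊖ k) ≈ powℕ x m ∙ powℕ x k ⁻¹
  pow-⊖ x zero    zero    = ≈-sym (≈-trans (identityˡ _) ε⁻¹≈ε)
  pow-⊖ x zero    (suc k) = ≈-sym (identityˡ _)
  pow-⊖ x (suc m) zero    = ≈-sym (≈-trans (∙-congˡ ε⁻¹≈ε) (identityʳ _))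
  pow-⊖ x (suc m) (suc k) = begin
    pow x (suc m ℤ.⊖ suc k)                ≡⟨ cong (pow x) (ℤ.[1+m]⊖[1+n]≡m⊖n m k) ⟩
    pow x (m ℤ.⊖ k)                        ≈⟨ pow-⊖ x m k ⟩
    powℕ x m ∙ powℕ x k ⁻¹                 ≈⟨ identityˡ _ ⟨
    ε ∙ (powℕ x m ∙ powℕ x k ⁻¹)           ≈⟨ ∙-congʳ (inverseʳ x) ⟨
    (x ∙ x ⁻¹) ∙ (powℕ x m ∙ powℕ x k ⁻¹)  ≈⟨ interchange _ _ _ _ ⟩
    (x ∙ powℕ x m) ∙ (x ⁻¹ ∙ powℕ x k ⁻¹)  ≈⟨ ∙-congˡ (⁻¹-∙-comm x (powℕ x k)) ⟩
    powℕ x (suc m) ∙ powℕ x (suc k) ⁻¹     ∎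

  pow-+ : ∀ x i j → pow x (i + j) ≈ pow x i ∙ pow x j
  pow-+ x (+ m)    (+ k)    = powℕ-+ x m k
  pow-+ x (+ m)    -[1+ k ] = pow-⊖ x m (suc k)
  pow-+ x -[1+ m ] (+ k)    = ≈-trans (pow-⊖ x k (suc m)) (comm _ _)
  pow-+ x -[1+ m ] -[1+ k ] = begin
    powℕ x (suc (suc (m ℕ.+ k))) ⁻¹        ≈⟨ ⁻¹-cong (∙-congˡ (powℕ-+ x (suc m) k)) ⟩
    (x ∙ (powℕ x (suc m) ∙ powℕ x k)) ⁻¹   ≈⟨ ⁻¹-cong (x∙yz≈y∙xz x _ _) ⟩
    (powℕ x (suc m) ∙ powℕ x (suc k)) ⁻¹   ≈⟨ ⁻¹-∙-comm _ _ ⟨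
    powℕ x (suc m) ⁻¹ ∙ powℕ x (suc k) ⁻¹  ∎

  pow-neg : ∀ x i → pow x (- i) ≈ pow x i ⁻¹
  pow-neg x (+ zero)  = ≈-sym ε⁻¹≈ε
  pow-neg x (+ suc m) = ≈-refl
  pow-neg x -[1+ m ]  = ≈-sym (⁻¹-involutive _)

  pow-∙ : ∀ x y i → pow (x ∙ y) i ≈ pow x i ∙ pow y i
  pow-∙ x y (+ m)    = powℕ-∙ x y m
  pow-∙ x y -[1+ m ] = ≈-trans (⁻¹-cong (powℕ-∙ x y (suc m))) (≈-sym (⁻¹-∙-comm _ _))

  powℕ-* : ∀ x i k → powℕ (pow x i) k ≈ pow x (i * + k)
  powℕ-* x i zero    = reflexive (cong (pow x) (sym (ℤ.*-zeroʳ i)))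
  powℕ-* x i (suc k) = begin
    pow x i ∙ powℕ (pow x i) k   ≈⟨ ∙-congˡ (powℕ-* x i k) ⟩
    pow x i ∙ pow x (i * + k)    ≈⟨ pow-+ x i (i * + k) ⟨
    pow x (i + i * + k)          ≡⟨ cong (pow x) (sym (ℤ.*-suc i (+ k))) ⟩
    pow x (i * + suc k)          ∎

  pow-* : ∀ x i j → pow (pow x i) j ≈ pow x (i * j)
  pow-* x i (+ k)    = powℕ-* x i k
  pow-* x i -[1+ k ] = begin
    powℕ (pow x i) (suc k) ⁻¹    ≈⟨ ⁻¹-cong (powℕ-* x i (suc k)) ⟩
    pow x (i * + suc k) ⁻¹       ≈⟨ pow-neg x (i * + suc k) ⟨
    pow x (- (i * + suc k))      ≡⟨ cong (pow x) (ℤ.neg-distribʳ-* i (+ suc k)) ⟩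
    pow x (i * -[1+ k ])         ∎

  ∏-cong : ∀ k {g h : ℕ → Carrier} → (∀ i → g i ≈ h i) → ∏ k g ≈ ∏ k h
  ∏-cong zero    g≈h = ≈-refl
  ∏-cong (suc k) g≈h = ∙-cong (∏-cong k g≈h) (g≈h k)

  ∏-∙ : ∀ k (g h : ℕ → Carrier) → ∏ k (λ i → g i ∙ h i) ≈ ∏ k g ∙ ∏ k h
  ∏-∙ zero    g h = ≈-sym (identityˡ ε)
  ∏-∙ (suc k) g h = ≈-trans (∙-congʳ (∏-∙ k g h)) (interchange _ _ _ _)

  ∏-pow : ∀ k x (g : ℕ → ℤ) → ∏ k (λ i → pow x (g i)) ≈ pow x (∑ k g)
  ∏-pow zero    x g = ≈-refl
  ∏-pow (suc k) x g = ≈-trans (∙-congʳ (∏-pow k x g)) (≈-sym (pow-+ x (∑ k g) (g k)))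

  ∏-pow-∙-pow : ∀ k (y : ℕ → Carrier) u (i j : ℕ → ℤ) →
    ∏ k (λ l → pow (y l ∙ pow u (i l)) (j l)) ≈ ∏ k (λ l → pow (y l) (j l)) ∙ pow u (∑ k (λ l → i l * j l))
  ∏-pow-∙-pow k y u i j = begin
    ∏ k (λ l → pow (y l ∙ pow u (i l)) (j l))
      ≈⟨ ∏-cong k (λ l → ≈-trans (pow-∙ _ _ (j l)) (∙-congˡ (pow-* u (i l) (j l)))) ⟩
    ∏ k (λ l → pow (y l) (j l) ∙ pow u (i l * j l))
      ≈⟨ ∏-∙ k _ _ ⟩
    ∏ k (λ l → pow (y l) (j l)) ∙ ∏ k (λ l → pow u (i l * j l))
      ≈⟨ ∙-congˡ (∏-pow k u _) ⟩
    ∏ k (λ l → pow (y l) (j l)) ∙ pow u (∑ k (λ l → i l * j l)) ∎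

module _ {a ℓ : Level} (𝔾 : AbelianGroup a ℓ) (p m : ℕ) (α β : ℤ) (E F : ℕ → AbelianGroup.Carrier 𝔾)
         (e f : ℕ → ℤ) (C₁ C₂ : ℤ) where

  open AbelianGroup 𝔾 hiding (_-_) renaming (refl to ≈-refl; sym to ≈-sym; trans to ≈-trans)
  open GroupOps 𝔾
  open IntegerPowers 𝔾
  open Units p (suc (suc m)) α β E F using (G; H; Glast; Hlast)
  open Exponents p m α β e f using (H-exponent; E-exponent; F-exponent)
  open import Algebra.Solver.CommutativeMonoid commutativeMonoid using (solve; _⊜_; _⊕_)
  open import Relation.Binary.Reasoning.Setoid setoid

  private
    E′ F′ ∏E ∏F : Carrier
    E′ = E (suc m)
    F′ = F (suc m)
    ∏E = ∏ (suc m) (λ i → pow (E i) (e i))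
    ∏F = ∏ m (λ j → pow (F (suc j)) (f (suc j)))

  collect-rhs :
    ∏ (suc m) (λ i → pow (G i) (e i)) ∙ ∏ m (λ j → pow (H (suc j)) (f (suc j))) ∙ pow Glast C₁ ∙ pow Hlast C₂
    ≈ (∏E ∙ pow E′ (E-exponent C₁)) ∙ (∏F ∙ pow F′ (F-exponent C₁ C₂))
  collect-rhs = begin
    ∏ (suc m) (λ i → pow (G i) (e i)) ∙ ∏ m (λ j → pow (H (suc j)) (f (suc j))) ∙ pow Glast C₁ ∙ pow Hlast C₂
      ≈⟨ ∙-cong (∙-cong (∙-cong ∏G ∏H) Glast^C₁) (pow-* F′ (+ (12 ℕ.* p)) C₂) ⟩
    ((((∏E ∙ pow E′ a₁) ∙ pow F′ b₁) ∙ (∏F ∙ pow F′ b₂)) ∙ (pow E′ a₂ ∙ pow F′ b₃)) ∙ pow F′ b₄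
      ≈⟨ rearrange _ _ _ _ _ _ _ _ ⟩
    (∏E ∙ (pow E′ a₁ ∙ pow E′ a₂)) ∙ (∏F ∙ (((pow F′ b₁ ∙ pow F′ b₂) ∙ pow F′ b₃) ∙ pow F′ b₄))
      ≈⟨ ∙-cong (∙-congˡ (pow-+ E′ a₁ a₂)) (∙-congˡ (pow-+₄ F′ b₁ b₂ b₃ b₄)) ⟨
    (∏E ∙ pow E′ (E-exponent C₁)) ∙ (∏F ∙ pow F′ (F-exponent C₁ C₂)) ∎
    where
    a₁ a₂ b₁ b₂ b₃ b₄ : ℤ
    a₁ = ∑ (suc m) (λ i → - a2 α i * e i)
    a₂ = + p * C₁
    b₁ = ∑ (suc m) (λ i → + p * (a2 α i - + 1) * e i)
    b₂ = ∑ m (λ i → H-exponent (suc i) * f (suc i))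
    b₃ = - (β * + p) * C₁
    b₄ = + (12 ℕ.* p) * C₂
    ∏G : ∏ (suc m) (λ i → pow (G i) (e i)) ≈ (∏E ∙ pow E′ a₁) ∙ pow F′ b₁
    ∏G = ≈-trans (∏-pow-∙-pow (suc m) (λ i → E i ∙ pow E′ (- a2 α i)) F′ (λ i → + p * (a2 α i - + 1)) e)
                 (∙-congʳ (∏-pow-∙-pow (suc m) E E′ (λ i → - a2 α i) e))
    ∏H : ∏ m (λ j → pow (H (suc j)) (f (suc j))) ≈ ∏F ∙ pow F′ b₂
    ∏H = ∏-pow-∙-pow m (F ∘ suc) F′ (H-exponent ∘ suc) (f ∘ suc)
    Glast^C₁ : pow Glast C₁ ≈ pow E′ a₂ ∙ pow F′ b₃
    Glast^C₁ = ≈-trans (pow-∙ _ _ C₁) (∙-cong (pow-* E′ (+ p) C₁) (pow-* F′ (- (β * + p)) C₁))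
    rearrange : ∀ a b c d e f g h →
      ((((a ∙ b) ∙ c) ∙ (d ∙ e)) ∙ (f ∙ g)) ∙ h ≈ (a ∙ (b ∙ f)) ∙ (d ∙ (((c ∙ e) ∙ g) ∙ h))
    rearrange = solve 8 (λ a b c d e f g h →
      ((((a ⊕ b) ⊕ c) ⊕ (d ⊕ e)) ⊕ (f ⊕ g)) ⊕ h ⊜ (a ⊕ (b ⊕ f)) ⊕ (d ⊕ (((c ⊕ e) ⊕ g) ⊕ h))) ≈-refl
    pow-+₄ : ∀ x i j k l → pow x (i + j + k + l) ≈ ((pow x i ∙ pow x j) ∙ pow x k) ∙ pow x l
    pow-+₄ x i j k l =
      ≈-trans (pow-+ x (i + j + k) l) (∙-congʳ (≈-trans (pow-+ x (i + j) k) (∙-congʳ (pow-+ x i j))))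

  product-identity : E-exponent C₁ ≡ e (suc m) → F-exponent C₁ C₂ ≡ f (suc m) →
                     ProductIdentity 𝔾 p (suc (suc m)) α β E F e f C₁ C₂
  product-identity E-exp≡ F-exp≡ = ≈-sym (≈-trans collect-rhs
    (∙-cong (∙-congˡ (reflexive (cong (pow E′) E-exp≡))) (∙-congˡ (reflexive (cong (pow F′) F-exp≡)))))

lemma8p7 : (p n : ℕ) → Prime p → p ≥ 5 → p ≡ 2 ℕ.* n ℕ.+ 1 →
  (α : ℤ) → GeneratesUnitsMod p α →
  (β : ℤ) → IsPm1Pm5 β → + 12 ∣ (+ p - β) →
  (e f : ℕ → ℤ) →
  + p ∣ ∑ n (λ i → e i * α ^ℤ (2 ℕ.* i)) →
  + p ∣ ∑ (n ∸ 1) (λ j → f (suc j) * α ^ℤ (2 ℕ.* suc j)) →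
  + 12 ∣ (∑ n (λ i → + p * e i) + ∑ (n ∸ 1) (λ j → f (suc j))) →
  (c ℓ : Level) →
  ∃₂ λ (C₁ C₂ : ℤ) →
       (+ p * C₁ ≡ e (n ∸ 1) + ∑ (n ∸ 1) (λ i → a2 α i * e i))
     × (+ (12 ℕ.* p) * C₂ ≡ f (n ∸ 1) + C₁ * β * + p
          - ∑ (n ∸ 2) (λ i → f (suc i) * (- a2 α (suc i) + + p * β * (a2 α (suc i) - + 1)))
          - ∑ (n ∸ 1) (λ i → + p * e i * (a2 α i - + 1)))
     × ((A : AbelianGroup c ℓ) (E F : ℕ → AbelianGroup.Carrier A) →
          ProductIdentity A p n α β E F e f C₁ C₂)
lemma8p7 _ zero          _ (ℕ.s≤s ())                 refl
lemma8p7 _ (suc zero)    _ (ℕ.s≤s (ℕ.s≤s (ℕ.s≤s ()))) refl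
lemma8p7 p (suc (suc m)) prime-p p≥5 p≡2n+1 α generates β β∈ 12∣p-β e f p∣∑eα p∣∑fα 12∣∑ c ℓ =
  C₁ , C₂ , pC₁≡num , 12pC₂≡num , λ 𝔾 E F →
    product-identity 𝔾 p m α β E F e f C₁ C₂ (E-exponent≡ pC₁≡num) (F-exponent≡ 12pC₂≡num)
  where
  open Exponents p m α β e f
  p-1≡2n : p ∸ 1 ≡ 2 ℕ.* suc m ℕ.+ 2
  p-1≡2n = trans (cong (_∸ 1) p≡2n+1) (trans (ℕ.m+n∸n≡m _ 1) (trans (ℕ.*-suc 2 (suc m)) (ℕ.+-comm 2 _)))
  p∣α²ⁿ-1 : + p ∣ₛ a2 α (suc m) - + 1
  p∣α²ⁿ-1 = subst (λ k → + p ∣ₛ α ^ℤ k - + 1) p-1≡2n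
    (fermat-unit prime-p α (generator⇒p∤ (ℕ.≤-trans (ℕ.m≤n+m 3 2) p≥5) generates))
  p∣C₁-numerator : + p ∣ₛ C₁-numerator
  p∣C₁-numerator = ∣-shift-weights α (suc m) e (λ i → i) p∣α²ⁿ-1 (∣ᵤ⇒∣ p∣∑eα)
  C₁ : ℤ
  C₁ = _∣ₛ_.quotient p∣C₁-numerator
  pC₁≡num : + p * C₁ ≡ C₁-numerator
  pC₁≡num = quotient-spec p∣C₁-numerator
  12p∣C₂-numerator′ : + (12 ℕ.* p) ∣ₛ C₂-numerator C₁
  12p∣C₂-numerator′ = 12p∣C₂-numerator pC₁≡num (∣-shift-weights α m (f ∘ suc) suc p∣α²ⁿ-1 (∣ᵤ⇒∣ p∣∑fα))
                                       (∣ᵤ⇒∣ 12∣p-β) β∈ (∣ᵤ⇒∣ 12∣∑)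
  C₂ : ℤ
  C₂ = _∣ₛ_.quotient 12p∣C₂-numerator′
  12pC₂≡num : + (12 ℕ.* p) * C₂ ≡ C₂-numerator C₁
  12pC₂≡num = quotient-spec 12p∣C₂-numerator′
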